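{- Let $T$ be a tree of order $n$ with $k$ peripheral vertices. Then \[ PWW(T)=\sum_{\{u,v\}\subseteq V(T)} a_1(\pi_{uv})\,a_2(\pi_{uv}), \] where the sum is over unordered pairs of distinct vertices, $\pi_{uv}$ is the unique path from $u$ to $v$ in $T$, and $a_1(\pi_{uv})$, $a_2(\pi_{uv})$ are the numbers of peripheral vertices of $T$ lying on the two sides of $\pi_{uv}$.
   Context: Trees are finite with at least two vertices. $d(u,v)$ is the distance in $T$. The eccentricity of $v$ is $\max_u d(u,v)$; the diameter is the maximum eccentricity; a vertex is peripheral if its eccentricity equals the diameter; $\operatorname{Peri}(T)$ is the set of peripheral vertices. $PWW(T)=\frac12\sum_{\{x,y\}\subseteq\operatorname{Peri}(T)}(d(x,y)+d(x,y)^2)$ over unordered pairs of distinct peripheral vertices. The two sides of $\pi_{uv}$: $a_1(\pi_{uv})$ is the number of peripheral vertices $x$ such that $u$ lies on the path from $x$ to $v$ (equivalently, $x$ lies in the component containing $u$ of $T$ with the edges of $\pi_{uv}$ removed), and $a_2(\pi_{uv})$ is defined symmetrically with the roles of $u$ and $v$ exchanged. -}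

module Defs where

open import Data.Nat using (ℕ; zero; suc; _+_; _*_; _≤_; _<_; _≡ᵇ_; _<ᵇ_; _⊔_; _/_)
open import Data.Fin using (Fin; toℕ; _≟_)
open import Data.List using (List; []; _∷_; length; map; allFin; foldr)
open import Data.Nat.ListAction using (sum)
open import Data.List.Relation.Unary.Unique.Propositional using (Unique)
open import Data.Bool using (Bool; true; false; _∧_; _∨_; if_then_else_)
open import Data.Maybe using (just)
open import Data.Product using (_×_; Σ)
open import Relation.Nullary.Decidable using (⌊_⌋)
open import Relation.Binary.PropositionalEquality using (_≡_)
open import Data.Empty using (⊥)

record Graph (n : ℕ) : Set where
  field
    adj   : Fin n → Fin n → Bool
    sym   : ∀ u v → adj u v ≡ adj v u
    irrefl : ∀ v → adj v v ≡ false
open Graph public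

data Walk {n : ℕ} (G : Graph n) : Fin n → Fin n → Set where
  here : ∀ {v} → Walk G v v
  step : ∀ {u w v} → adj G u w ≡ true → Walk G w v → Walk G u v

Connected : ∀ {n} → Graph n → Set
Connected G = ∀ u v → Walk G u v

Chain : ∀ {n} → Graph n → List (Fin n) → Set
Chain G [] = Data.Unit.⊤ where import Data.Unit
Chain G (x ∷ []) = Data.Unit.⊤ where import Data.Unit
Chain G (x ∷ y ∷ xs) = (adj G x y ≡ true) × Chain G (y ∷ xs)

lastOf : ∀ {A : Set} → A → List A → A
lastOf a [] = a
lastOf a (b ∷ bs) = lastOf b bs

IsCycle : ∀ {n} → Graph n → List (Fin n) → Set
IsCycle G [] = ⊥
IsCycle G (x ∷ []) = ⊥
IsCycle G (x ∷ y ∷ []) = ⊥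
IsCycle G (x ∷ y ∷ z ∷ xs) =
  Unique (x ∷ y ∷ z ∷ xs) × Chain G (x ∷ y ∷ z ∷ xs) × (adj G (lastOf z xs) x ≡ true)

Acyclic : ∀ {n} → Graph n → Set
Acyclic G = ∀ (c : List (Fin _)) → IsCycle G c → ⊥

record Tree (n : ℕ) : Set where
  field
    graph     : Graph n
    connected : Connected graph
    acyclic   : Acyclic graph
open Tree public

module _ {n : ℕ} (T : Tree n) where
  private G = graph T

  reach : ℕ → Fin n → Fin n → Bool
  reach zero u v = ⌊ u ≟ v ⌋
  reach (suc k) u v = reach k u v ∨ foldr _∨_ false (map (λ w → reach k u w ∧ adj G w v) (allFin n))

  minFrom : (ℕ → Bool) → ℕ → ℕ → ℕ
  minFrom f i zero = i
  minFrom f i (suc fuel) = if f i then i else minFrom f (suc i) fuel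

  -- graph distance d(u,v) = length of a shortest walk (T connected, so found within n steps)
  dist : Fin n → Fin n → ℕ
  dist u v = minFrom (λ k → reach k u v) 0 n

  maxOver : (Fin n → ℕ) → ℕ
  maxOver f = foldr _⊔_ 0 (map f (allFin n))

  ecc : Fin n → ℕ
  ecc v = maxOver (λ u → dist u v)

  diam : ℕ
  diam = maxOver ecc

  peripheral : Fin n → Bool
  peripheral v = ecc v ≡ᵇ diam

  sumPairs : (Fin n → Fin n → ℕ) → ℕ
  sumPairs f = sum (map (λ x → sum (map (λ y → if toℕ x <ᵇ toℕ y then f x y else 0) (allFin n))) (allFin n))

  countP : (Fin n → Bool) → ℕ
  countP p = sum (map (λ x → if p x then 1 else 0) (allFin n))

  PWW : ℕ
  PWW = sumPairs (λ x y → if peripheral x ∧ peripheral y then dist x y + dist x y * dist x y else 0) / 2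

  -- u lies on the (unique) path from x to v
  onPath : Fin n → Fin n → Fin n → Bool
  onPath x v u = (dist x u + dist u v) ≡ᵇ dist x v

  a₁ : Fin n → Fin n → ℕ
  a₁ u v = countP (λ x → peripheral x ∧ onPath x v u)

  a₂ : Fin n → Fin n → ℕ
  a₂ u v = countP (λ x → peripheral x ∧ onPath x u v)

-- Expanding a₁(u,v)·a₂(u,v) as a sum over pairs (x, y) of peripheral vertices, the right-hand side
-- counts, for each such pair, the ordered pairs u ≠ v with u on the x–v path and v on the y–u path,
-- i.e. the vertices met in the order x, u, v, y along the x–y path: (d + d²)/2 of them, where
-- d = d(x, y). This count is proved by induction on d, moving y one step towards x along an edge y′y.
-- Every vertex lies on the y-side or on the y′-side of that edge, and a path from one side to the
-- other runs through y′ and y; this is where acyclicity enters.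

module Submission where

open import Defs renaming (sym to adj-sym; irrefl to adj-irrefl)

open import Data.Bool using (Bool; true; false; _∧_; _∨_; if_then_else_)
open import Data.Bool.Properties using (T-≡; ∨-zeroʳ; ∧-comm) renaming (_≟_ to _≟𝔹_)
open import Data.Empty using (⊥)
open import Data.Fin using (Fin; zero; suc; toℕ; _≟_)
open import Data.Fin.Properties using (toℕ-injective; any?)
open import Data.List using (List; []; _∷_; _++_; [_]; map; allFin; tabulate; foldr)
open import Data.List.Properties using (map-tabulate; ++-assoc)
open import Data.List.Membership.Propositional using (_∈_; lose)
open import Data.List.Membership.Propositional.Properties using (∈-allFin; ∈-∃++)
open import Data.List.Relation.Unary.All as All using (All; []; _∷_)
open import Data.List.Relation.Unary.All.Properties using (++⁻ˡ; ¬Any⇒All¬)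
open import Data.List.Relation.Unary.AllPairs using ([]; _∷_)
open import Data.List.Relation.Unary.Any as Any using (here; there; satisfied)
open import Data.List.Relation.Unary.Any.Properties using (any⁺; any⁻)
open import Data.List.Relation.Unary.Unique.Propositional using (Unique)
open import Data.Nat using (ℕ; zero; suc; _+_; _*_; _/_; _≤_; _<_; _<ᵇ_; z≤n; s≤s; s≤s⁻¹; z<s)
open import Data.Nat.DivMod using (m*n/n≡m)
open import Data.Nat.ListAction using () renaming (sum to listSum)
open import Data.Nat.Properties renaming (_≟_ to _≟ℕ_)
open import Algebra.Properties.Semiring.Sum +-*-semiring
  using (sum-syntax; sum-cong-≗; sum-replicate-zero; ∑-distrib-+; ∑-comm; *-distribˡ-sum; *-distribʳ-sum)
open import Data.Nat.Tactic.RingSolver using (solve-∀)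
open import Data.Product using (∃; _×_; _,_; proj₁; proj₂)
open import Data.Sum using (_⊎_; inj₁; inj₂)
open import Data.Unit using (tt)
open import Function using (_∘_; id)
open import Function.Bundles using (Equivalence; _⇔_; mk⇔)
import Function.Properties.Equivalence as ⇔
open import Relation.Binary.Definitions using (tri<; tri≈; tri>)
open import Relation.Binary.PropositionalEquality hiding ([_])
open import Relation.Nullary using (¬_; does; yes; no; contradiction)
open import Relation.Nullary.Decidable using (dec-true; dec-false; does-⇔; toWitness; fromWitness; _×-dec_)

𝟙 : Bool → ℕ
𝟙 b = if b then 1 else 0

sum-tabulate : ∀ {n} (f : Fin n → ℕ) → listSum (tabulate f) ≡ ∑[ i < n ] f i
sum-tabulate {zero}  f = refl
sum-tabulate {suc n} f = cong (f zero +_) (sum-tabulate (f ∘ suc))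

sum-map-allFin : ∀ {n} (f : Fin n → ℕ) → listSum (map f (allFin n)) ≡ ∑[ i < n ] f i
sum-map-allFin f = trans (cong listSum (map-tabulate id f)) (sum-tabulate f)

∑-mono-≤ : ∀ {n} {f g : Fin n → ℕ} → (∀ i → f i ≤ g i) → ∑[ i < n ] f i ≤ ∑[ i < n ] g i
∑-mono-≤ {zero}  f≤g = z≤n
∑-mono-≤ {suc n} f≤g = +-mono-≤ (f≤g zero) (∑-mono-≤ (f≤g ∘ suc))

∑-mono-< : ∀ {n} {f g : Fin n → ℕ} → (∀ i → f i ≤ g i) → ∀ w → f w < g w →
           ∑[ i < n ] f i < ∑[ i < n ] g i
∑-mono-< f≤g zero    fw<gw = +-mono-<-≤ fw<gw (∑-mono-≤ (f≤g ∘ suc))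
∑-mono-< f≤g (suc w) fw<gw = +-mono-≤-< (f≤g zero) (∑-mono-< (f≤g ∘ suc) w fw<gw)

𝟙≤1 : ∀ b → 𝟙 b ≤ 1
𝟙≤1 true  = ≤-refl
𝟙≤1 false = z≤n

∑-𝟙≤n : ∀ {n} (p : Fin n → Bool) → ∑[ i < n ] 𝟙 (p i) ≤ n
∑-𝟙≤n {zero}  p = z≤n
∑-𝟙≤n {suc n} p = +-mono-≤ (𝟙≤1 (p zero)) (∑-𝟙≤n (p ∘ suc))

infixl 7 _without_

_without_ : ∀ {n} → (Fin n → ℕ) → Fin n → (Fin n → ℕ)
(f without w) u = if does (u ≟ w) then 0 else f u

∑-without : ∀ {n} (f : Fin n → ℕ) w → ∑[ u < n ] f u ≡ ∑[ u < n ] (f without w) u + f w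
∑-without f zero    = +-comm (f zero) _
∑-without f (suc w) = trans (cong (f zero +_) (∑-without (f ∘ suc) w)) (sym (+-assoc (f zero) _ _))

without-cong : ∀ {n} {f g : Fin n → ℕ} {w} u → (u ≢ w → f u ≡ g u) →
               (f without w) u ≡ (g without w) u
without-cong {w = w} u f≡g with u ≟ w
... | yes _   = refl
... | no  u≢w = f≡g u≢w

∑-without-cong : ∀ {n} {f g : Fin n → ℕ} {w} → (∀ u → u ≢ w → f u ≡ g u) →
                 ∑[ u < n ] (f without w) u ≡ ∑[ u < n ] (g without w) u
∑-without-cong {f = f} {g} f≡g = sum-cong-≗ (λ u → without-cong {f = f} {g} u (f≡g u))

∑-zero : ∀ {n} {f : Fin n → ℕ} → (∀ i → f i ≡ 0) → ∑[ i < n ] f i ≡ 0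
∑-zero {n} f≗0 = trans (sum-cong-≗ f≗0) (sum-replicate-zero n)

term≤∑ : ∀ {n} (f : Fin n → ℕ) w → f w ≤ ∑[ i < n ] f i
term≤∑ f w = subst (f w ≤_) (sym (∑-without f w)) (m≤n+m (f w) _)

upper : ∀ {n} → (Fin n → Fin n → ℕ) → Fin n → Fin n → ℕ
upper h x y = if toℕ x <ᵇ toℕ y then h x y else 0

module _ {n : ℕ} (h : Fin n → Fin n → ℕ) {x y : Fin n} where

  upper-< : toℕ x < toℕ y → upper h x y ≡ h x y
  upper-< x<y rewrite dec-true (toℕ x <? toℕ y) x<y = refl

  upper-≥ : toℕ y ≤ toℕ x → upper h x y ≡ 0
  upper-≥ y≤x rewrite dec-false (toℕ x <? toℕ y) (≤⇒≯ y≤x) = refl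

offDiagonal : ∀ {n} → (Fin n → Fin n → ℕ) → Fin n → Fin n → ℕ
offDiagonal h x y = if does (x ≟ y) then 0 else h x y

offDiagonal-split : ∀ {n} (h : Fin n → Fin n → ℕ) → (∀ x y → h x y ≡ h y x) →
                    ∀ x y → offDiagonal h x y ≡ upper h x y + upper h y x
offDiagonal-split h h-sym x y with x ≟ y | <-cmp (toℕ x) (toℕ y)
... | yes refl | _            = sym (cong₂ _+_ (upper-≥ h {x} ≤-refl) (upper-≥ h {x} ≤-refl))
... | no x≢y   | tri< x<y _ _ = sym (trans (cong₂ _+_ (upper-< h x<y) (upper-≥ h (<⇒≤ x<y))) (+-identityʳ _))
... | no x≢y   | tri≈ _ x≡y _ = contradiction (toℕ-injective x≡y) x≢y
... | no x≢y   | tri> _ _ y<x = sym (trans (cong₂ _+_ (upper-≥ h (<⇒≤ y<x)) (upper-< h y<x)) (h-sym y x))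

∑-offDiagonal-sym : ∀ {n} (h : Fin n → Fin n → ℕ) → (∀ x y → h x y ≡ h y x) →
  ∑[ x < n ] ∑[ y < n ] offDiagonal h x y ≡ 2 * ∑[ x < n ] ∑[ y < n ] upper h x y
∑-offDiagonal-sym {n} h h-sym = begin
  ∑[ x < n ] ∑[ y < n ] offDiagonal h x y
    ≡⟨ sum-cong-≗ (λ x → sum-cong-≗ (offDiagonal-split h h-sym x)) ⟩
  ∑[ x < n ] ∑[ y < n ] (upper h x y + upper h y x)
    ≡⟨ sum-cong-≗ (λ x → ∑-distrib-+ (upper h x) (λ y → upper h y x)) ⟩
  ∑[ x < n ] (∑[ y < n ] upper h x y + ∑[ y < n ] upper h y x)
    ≡⟨ ∑-distrib-+ (λ x → ∑[ y < n ] upper h x y) (λ x → ∑[ y < n ] upper h y x) ⟩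
  ∑[ x < n ] ∑[ y < n ] upper h x y + ∑[ x < n ] ∑[ y < n ] upper h y x
    ≡⟨ cong (U +_) (trans (∑-comm (λ x y → upper h y x)) (sym (+-identityʳ U))) ⟩
  2 * U ∎
  where
  open ≡-Reasoning
  U : ℕ
  U = ∑[ x < n ] ∑[ y < n ] upper h x y

∑*∑ : ∀ {n} (f g : Fin n → ℕ) →
      (∑[ x < n ] f x) * (∑[ y < n ] g y) ≡ ∑[ x < n ] ∑[ y < n ] (f x * g y)
∑*∑ f g = trans (*-distribʳ-sum _ f) (sum-cong-≗ (λ x → *-distribˡ-sum (f x) g))

*-distribˡ-∑∑ : ∀ {n} c (h : Fin n → Fin n → ℕ) →
                c * ∑[ x < n ] ∑[ y < n ] h x y ≡ ∑[ x < n ] ∑[ y < n ] (c * h x y)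
*-distribˡ-∑∑ {n} c h =
  trans (*-distribˡ-sum c (λ x → ∑[ y < n ] h x y)) (sum-cong-≗ (λ x → *-distribˡ-sum c (h x)))

∑∑-comm : ∀ {n} (F : Fin n → Fin n → Fin n → Fin n → ℕ) →
          ∑[ u < n ] ∑[ v < n ] ∑[ x < n ] ∑[ y < n ] F u v x y ≡
          ∑[ x < n ] ∑[ y < n ] ∑[ u < n ] ∑[ v < n ] F u v x y
∑∑-comm {n} F = begin
  ∑[ u < n ] ∑[ v < n ] ∑[ x < n ] ∑[ y < n ] F u v x y
    ≡⟨ sum-cong-≗ (λ u → ∑-comm (λ v x → ∑[ y < n ] F u v x y)) ⟩
  ∑[ u < n ] ∑[ x < n ] ∑[ v < n ] ∑[ y < n ] F u v x y
    ≡⟨ ∑-comm (λ u x → ∑[ v < n ] ∑[ y < n ] F u v x y) ⟩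
  ∑[ x < n ] ∑[ u < n ] ∑[ v < n ] ∑[ y < n ] F u v x y
    ≡⟨ sum-cong-≗ (λ x → sum-cong-≗ (λ u → ∑-comm (λ v y → F u v x y))) ⟩
  ∑[ x < n ] ∑[ u < n ] ∑[ y < n ] ∑[ v < n ] F u v x y
    ≡⟨ sum-cong-≗ (λ x → ∑-comm (λ u y → ∑[ v < n ] F u v x y)) ⟩
  ∑[ x < n ] ∑[ y < n ] ∑[ u < n ] ∑[ v < n ] F u v x y ∎
  where open ≡-Reasoning

offDiagonal-∑∑ : ∀ {n} (c : Fin n → Fin n → ℕ) (h : Fin n → Fin n → Fin n → Fin n → ℕ) u v →
  offDiagonal (λ u v → ∑[ x < n ] ∑[ y < n ] (c x y * h x y u v)) u v ≡
  ∑[ x < n ] ∑[ y < n ] (c x y * offDiagonal (h x y) u v)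
offDiagonal-∑∑ c h u v with u ≟ v
... | yes _ = sym (∑-zero (λ x → ∑-zero (λ y → *-zeroʳ (c x y))))
... | no  _ = refl

or-allFin⁺ : ∀ {n} (f : Fin n → Bool) w → f w ≡ true → foldr _∨_ false (map f (allFin n)) ≡ true
or-allFin⁺ f w fw = Equivalence.to T-≡ (any⁺ f (lose (∈-allFin w) (Equivalence.from T-≡ fw)))

or-allFin⁻ : ∀ {n} (f : Fin n → Bool) → foldr _∨_ false (map f (allFin n)) ≡ true →
             ∃ λ w → f w ≡ true
or-allFin⁻ {n} f or≡true
  with w , fw ← satisfied (any⁻ f (allFin n) (Equivalence.from T-≡ or≡true)) = w , Equivalence.to T-≡ fw

∨≡true⁺ˡ : ∀ {a b} → a ≡ true → a ∨ b ≡ true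
∨≡true⁺ˡ refl = refl

∧≡true⁻ : ∀ {a b} → a ∧ b ≡ true → a ≡ true × b ≡ true
∧≡true⁻ {true} {true} _ = refl , refl

𝟙-mono : ∀ {a b} → (a ≡ true → b ≡ true) → 𝟙 a ≤ 𝟙 b
𝟙-mono {false} a⇒b = z≤n
𝟙-mono {true}  a⇒b rewrite a⇒b refl = ≤-refl

𝟙-∧-* : ∀ p q a b → 𝟙 (p ∧ a) * 𝟙 (q ∧ b) ≡ 𝟙 (p ∧ q) * (𝟙 a * 𝟙 b)
𝟙-∧-* true  true  a b = sym (+-identityʳ _)
𝟙-∧-* true  false a b = *-zeroʳ (𝟙 a)
𝟙-∧-* false q     a b = refl

Path : ∀ {n} → Graph n → List (Fin n) → Set
Path G xs = Unique xs × Chain G xs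

adj⇒≢ : ∀ {n} (G : Graph n) {u v} → adj G u v ≡ true → u ≢ v
adj⇒≢ G {u} a refl with () ← trans (sym a) (adj-irrefl G u)

module _ {n : ℕ} {G : Graph n} where

  unique-++⁻ˡ : ∀ (xs : List (Fin n)) {ys} → Unique (xs ++ ys) → Unique xs
  unique-++⁻ˡ []       _       = []
  unique-++⁻ˡ (x ∷ xs) (p ∷ u) = ++⁻ˡ xs p ∷ unique-++⁻ˡ xs u

  chain-++⁻ˡ : ∀ xs {ys} → Chain G (xs ++ ys) → Chain G xs
  chain-++⁻ˡ []           _       = tt
  chain-++⁻ˡ (x ∷ [])     _       = tt
  chain-++⁻ˡ (x ∷ y ∷ xs) (a , c) = a , chain-++⁻ˡ (y ∷ xs) c

  path-++⁻ˡ : ∀ xs {ys} → Path G (xs ++ ys) → Path G xs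
  path-++⁻ˡ xs (U , C) = unique-++⁻ˡ xs U , chain-++⁻ˡ xs C

  lastOf-∷ʳ : ∀ (z : Fin n) ys b → lastOf z (ys ++ [ b ]) ≡ b
  lastOf-∷ʳ z []       b = refl
  lastOf-∷ʳ z (y ∷ ys) b = lastOf-∷ʳ y ys b

  closed-path⇒cycle : ∀ {a c} ys {b} → Path G (a ∷ c ∷ ys ++ [ b ]) → adj G b a ≡ true →
                      ∃ λ cs → IsCycle G cs
  closed-path⇒cycle {a} {c} []       {b} (U , C) b~a = a ∷ c ∷ b ∷ [] , U , C , b~a
  closed-path⇒cycle {a} {c} (y ∷ ys) {b} (U , C) b~a =
    a ∷ c ∷ y ∷ ys ++ [ b ] , U , C , subst (λ z → adj G z a ≡ true) (sym (lastOf-∷ʳ y ys b)) b~a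

  -- If b already occurs in M, the part of the path up to b closes a cycle through the edge b–a.
  path-cons : Acyclic G → ∀ {a c b} M → Path G (a ∷ c ∷ M) → adj G b a ≡ true → b ≢ c →
              Path G (b ∷ a ∷ c ∷ M)
  path-cons acyclic {a} {c} {b} M (U , C) b~a b≢c with Any.any? (b ≟_) M
  ... | no b∉M = ((adj⇒≢ G b~a ∷ b≢c ∷ ¬Any⇒All¬ M b∉M) ∷ U) , b~a , C
  ... | yes b∈M with ys , zs , refl ← ∈-∃++ b∈M =
    contradiction (closed-path⇒cycle ys prefix b~a) (λ (cs , cyc) → acyclic cs cyc)
    where
    split : a ∷ c ∷ ys ++ b ∷ zs ≡ (a ∷ c ∷ ys ++ [ b ]) ++ zs
    split = cong (λ l → a ∷ c ∷ l) (sym (++-assoc ys [ b ] zs))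
    prefix : Path G (a ∷ c ∷ ys ++ [ b ])
    prefix = path-++⁻ˡ (a ∷ c ∷ ys ++ [ b ]) (subst (Path G) split (U , C))

module Reachability {n : ℕ} (T : Tree n) where

  private
    G = graph T

  -- A record rather than a bare equation, so that k, u and v can be inferred.
  record Reach (k : ℕ) (u v : Fin n) : Set where
    constructor reached
    field holds : reach T k u v ≡ true

  private
    variable
      k : ℕ
      u v w : Fin n

  reach-zero⁻ : Reach 0 u v → u ≡ v
  reach-zero⁻ (reached r) = toWitness (Equivalence.from T-≡ r)

  reach-weaken : Reach k u v → Reach (suc k) u v
  reach-weaken (reached r) = reached (∨≡true⁺ˡ r)

  reach-refl : ∀ k u → Reach k u u
  reach-refl zero    u = reached (Equivalence.to T-≡ (fromWitness refl))
  reach-refl (suc k) u = reach-weaken (reach-refl k u)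

  reach-snoc : Reach k u w → adj G w v ≡ true → Reach (suc k) u v
  reach-snoc {k} {u} {w} {v} (reached r) a =
    reached (trans (cong (reach T k u v ∨_) (or-allFin⁺ _ w (cong₂ _∧_ r a))) (∨-zeroʳ _))

  reach-suc⁻ : Reach (suc k) u v → Reach k u v ⊎ ∃ λ w → Reach k u w × adj G w v ≡ true
  reach-suc⁻ {k} {u} {v} (reached r) with reach T k u v in eq
  ... | true  = inj₁ (reached eq)
  ... | false with w , p ← or-allFin⁻ _ r with r , a ← ∧≡true⁻ p = inj₂ (w , reached r , a)

  reach-cons : adj G u w ≡ true → Reach k w v → Reach (suc k) u v
  reach-cons {k = zero} a r with refl ← reach-zero⁻ r = reach-snoc (reach-refl 0 _) a
  reach-cons {k = suc k} a r with reach-suc⁻ r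
  ... | inj₁ r′            = reach-weaken (reach-cons a r′)
  ... | inj₂ (z , r′ , a′) = reach-snoc (reach-cons a r′) a′

  reach-sym : Reach k u v → Reach k v u
  reach-sym {k = zero} r with refl ← reach-zero⁻ r = r
  reach-sym {k = suc k} r with reach-suc⁻ r
  ... | inj₁ r′            = reach-weaken (reach-sym r′)
  ... | inj₂ (w , r′ , a) = reach-cons (trans (adj-sym G _ _) a) (reach-sym r′)

  reach-trans : ∀ {j} → Reach j u w → Reach k w v → Reach (j + k) u v
  reach-trans {k = zero} {j = j} p q with refl ← reach-zero⁻ q rewrite +-identityʳ j = p
  reach-trans {k = suc k} {j = j} p q rewrite +-suc j k with reach-suc⁻ q
  ... | inj₁ q′            = reach-weaken (reach-trans p q′)
  ... | inj₂ (z , q′ , a) = reach-snoc (reach-trans p q′) a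

  walk⇒reach : Walk G u v → ∃ λ k → Reach k u v
  walk⇒reach here       = 0 , reach-refl 0 _
  walk⇒reach (step a w) with k , r ← walk⇒reach w = suc k , reach-cons a r

  reachCount : Fin n → ℕ → ℕ
  reachCount u j = ∑[ v < n ] 𝟙 (reach T j u v)

  Saturated : Fin n → ℕ → Set
  Saturated u j = ∀ {m v} → Reach m u v → Reach j u v

  closed⇒saturated : ∀ {j} → (∀ {v} → Reach (suc j) u v → Reach j u v) → Saturated u j
  closed⇒saturated {j = j} closed {zero} r with refl ← reach-zero⁻ r = reach-refl j _
  closed⇒saturated closed {suc m} r with reach-suc⁻ r
  ... | inj₁ r′            = closed⇒saturated closed r′
  ... | inj₂ (w , r′ , a) = closed (reach-snoc (closed⇒saturated closed r′) a)

  grows-or-saturated : ∀ u j → suc j ≤ reachCount u j ⊎ Saturated u j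
  grows-or-saturated u zero =
    inj₁ (subst (λ b → 𝟙 b ≤ reachCount u 0) (Reach.holds (reach-refl 0 u)) (term≤∑ _ u))
  grows-or-saturated u (suc j) with grows-or-saturated u j
  ... | inj₂ sat = inj₂ (reach-weaken ∘ sat)
  ... | inj₁ grown with any? (λ v → (reach T (suc j) u v ≟𝔹 true) ×-dec (reach T j u v ≟𝔹 false))
  ... | yes (v , new , ¬old) = inj₁ (≤-trans (s≤s grown) (∑-mono-< grows-pointwise v grows-at-v))
    where
    grows-pointwise : ∀ w → 𝟙 (reach T j u w) ≤ 𝟙 (reach T (suc j) u w)
    grows-pointwise w = 𝟙-mono (λ r → Reach.holds (reach-weaken (reached {j} {u} {w} r)))
    grows-at-v : 𝟙 (reach T j u v) < 𝟙 (reach T (suc j) u v)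
    grows-at-v rewrite new | ¬old = s≤s z≤n
  ... | no ¬new = inj₂ (closed⇒saturated closed)
    where
    closed : ∀ {v} → Reach (suc (suc j)) u v → Reach (suc j) u v
    closed r with reach-suc⁻ r
    ... | inj₁ r′ = r′
    ... | inj₂ (w , r′ , a) with reach T j u w in eq
    ...   | true  = reach-snoc (reached eq) a
    ...   | false = contradiction (w , Reach.holds r′ , eq) ¬new

  saturated-at-n : ∀ u → Saturated u n
  saturated-at-n u with grows-or-saturated u n
  ... | inj₁ n<count = contradiction (∑-𝟙≤n _) (<⇒≱ n<count)
  ... | inj₂ sat     = sat

  reach-n : ∀ u v → Reach n u v
  reach-n u v = saturated-at-n u (proj₂ (walk⇒reach (connected T u v)))

module Distance {n : ℕ} (T : Tree n) where

  open Reachability T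

  private
    G = graph T
    d = dist T
    variable
      k : ℕ
      u v w : Fin n

  minFrom-spec : ∀ (f : ℕ → Bool) fuel i → f (i + fuel) ≡ true →
    f (minFrom T f i fuel) ≡ true × (∀ {l} → i ≤ l → l < minFrom T f i fuel → f l ≡ false)
  minFrom-spec f zero i f[i] rewrite +-identityʳ i = f[i] , λ i≤l l<i → contradiction i≤l (<⇒≱ l<i)
  minFrom-spec f (suc fuel) i f[i+fuel] with f i in f[i]
  ... | true  = f[i] , λ i≤l l<i → contradiction i≤l (<⇒≱ l<i)
  ... | false
    with f[min] , below ← minFrom-spec f fuel (suc i) (subst (λ m → f m ≡ true) (+-suc i fuel) f[i+fuel])
    = f[min] , below′
    where
    below′ : ∀ {l} → i ≤ l → l < minFrom T f (suc i) fuel → f l ≡ false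
    below′ i≤l l<min with m≤n⇒m<n∨m≡n i≤l
    ... | inj₁ i<l  = below i<l l<min
    ... | inj₂ refl = f[i]

  private
    dist-spec : ∀ u v →
      reach T (d u v) u v ≡ true × (∀ {l} → 0 ≤ l → l < d u v → reach T l u v ≡ false)
    dist-spec u v = minFrom-spec (λ k → reach T k u v) n 0 (Reach.holds (reach-n u v))

  dist-reach : ∀ u v → Reach (d u v) u v
  dist-reach u v = reached (proj₁ (dist-spec u v))

  dist-least : Reach k u v → d u v ≤ k
  dist-least {k} {u} {v} (reached r) with d u v ≤? k
  ... | yes d≤k = d≤k
  ... | no  d≰k with () ← trans (sym r) (proj₂ (dist-spec u v) z≤n (≰⇒> d≰k))

  dist-self : ∀ u → d u u ≡ 0
  dist-self u = n≤0⇒n≡0 (dist-least (reach-refl 0 u))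

  dist≡0⇒≡ : d u v ≡ 0 → u ≡ v
  dist≡0⇒≡ {u} {v} d≡0 = reach-zero⁻ (subst (λ k → Reach k u v) d≡0 (dist-reach u v))

  dist-sym : ∀ u v → d u v ≡ d v u
  dist-sym u v = ≤-antisym (dist-least (reach-sym (dist-reach v u))) (dist-least (reach-sym (dist-reach u v)))

  dist-triangle : ∀ u w v → d u v ≤ d u w + d w v
  dist-triangle u w v = dist-least (reach-trans (dist-reach u w) (dist-reach w v))

  dist-adj : adj G u v ≡ true → d u v ≡ 1
  dist-adj {u} a =
    ≤-antisym (dist-least (reach-snoc (reach-refl 0 u) a)) (n≢0⇒n>0 (adj⇒≢ G a ∘ dist≡0⇒≡))

  dist-adj-≤ : adj G u w ≡ true → ∀ v → d u v ≤ suc (d w v)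
  dist-adj-≤ {u} {w} a v = subst (λ m → d u v ≤ m + d w v) (dist-adj a) (dist-triangle u w v)

  Between : Fin n → Fin n → Fin n → Set
  Between x u v = d x u + d u v ≡ d x v

  between-sym : ∀ {x u v} → Between x u v → Between v u x
  between-sym {x} {u} {v} btw = begin
    d v u + d u x ≡⟨ cong₂ _+_ (dist-sym v u) (dist-sym u x) ⟩
    d u v + d x u ≡⟨ +-comm (d u v) (d x u) ⟩
    d x u + d u v ≡⟨ btw ⟩
    d x v         ≡⟨ dist-sym x v ⟩
    d v x         ∎
    where open ≡-Reasoning

  between-antisym : ∀ {x u v} → Between x u v → Between x v u → u ≡ v
  between-antisym {x} {u} {v} xuv xvu = dist≡0⇒≡ (m+n≡0⇒m≡0 (d u v) (+-cancelˡ-≡ (d x u) _ 0 (begin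
    d x u + (d u v + d v u) ≡⟨ +-assoc (d x u) (d u v) (d v u) ⟨
    d x u + d u v + d v u   ≡⟨ cong (_+ d v u) xuv ⟩
    d x v + d v u           ≡⟨ xvu ⟩
    d x u                   ≡⟨ +-identityʳ (d x u) ⟨
    d x u + 0               ∎)))
    where open ≡-Reasoning

  onPath-true : ∀ {x u v} → Between x u v → onPath T x v u ≡ true
  onPath-true = dec-true (_ ≟ℕ _)

  onPath-false : ∀ {x u v} → ¬ Between x u v → onPath T x v u ≡ false
  onPath-false = dec-false (_ ≟ℕ _)

  onPath-sound : ∀ {x u v} → onPath T x v u ≡ true → Between x u v
  onPath-sound on = ≡ᵇ⇒≡ _ _ (Equivalence.from T-≡ on)

  onPath-cong : ∀ {x u v x′ u′ v′} → Between x u v ⇔ Between x′ u′ v′ →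
                onPath T x v u ≡ onPath T x′ v′ u′
  onPath-cong btw⇔btw′ = does-⇔ btw⇔btw′ (_ ≟ℕ _) (_ ≟ℕ _)

  dist-pred : d u v ≡ suc k → ∃ λ w → adj G w v ≡ true × d u w ≡ k
  dist-pred {u} {v} {k} d≡1+k with reach-suc⁻ (subst (λ j → Reach j u v) d≡1+k (dist-reach u v))
  ... | inj₁ r = contradiction (subst (_≤ k) d≡1+k (dist-least r)) (n≮n k)
  ... | inj₂ (w , r , a) = w , a , ≤-antisym (dist-least r) k≤d
    where
    k≤d : k ≤ d u w
    k≤d = +-cancelʳ-≤ 1 k (d u w) (subst (_≤ d u w + 1) (trans d≡1+k (+-comm 1 k))
            (≤-trans (dist-triangle u w v) (≤-reflexive (cong (d u w +_) (dist-adj a)))))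

  dist-succ : d u v ≡ suc k → ∃ λ w → adj G u w ≡ true × d w v ≡ k
  dist-succ {u} {v} d≡1+k with w , a , d≡k ← dist-pred (trans (dist-sym v u) d≡1+k) =
    w , trans (adj-sym G u w) a , trans (dist-sym w v) d≡k

module TreeGeometry {n : ℕ} (T : Tree n) where

  open Distance T

  private
    G = graph T
    d = dist T
    variable
      u v w w′ x y z : Fin n

  farther∉ : ∀ {zs} → d z y ≤ d x y → All (λ t → d t y < d z y) zs → All (x ≢_) zs
  farther∉ z≤x = All.map (λ { t<z refl → <⇒≱ t<z z≤x })

  geodesic : ∀ z y → ∃ λ zs → Path G (z ∷ zs) × y ∈ z ∷ zs × All (λ t → d t y < d z y) zs
  geodesic z y = build (d z y) z refl
    where
    build : ∀ k z → d z y ≡ k →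
            ∃ λ zs → Path G (z ∷ zs) × y ∈ z ∷ zs × All (λ t → d t y < k) zs
    build zero    z d≡0 with refl ← dist≡0⇒≡ d≡0 = [] , ([] ∷ [] , tt) , here refl , []
    build (suc k) z d≡1+k
      with z′ , z~z′ , d≡k ← dist-succ d≡1+k
      with zs , (U , C) , y∈ , nearer ← build k z′ d≡k =
      z′ ∷ zs , ((z∉ ∷ U) , z~z′ , C) , there y∈ , nearer′
      where
      nearer′ : All (λ t → d t y < suc k) (z′ ∷ zs)
      nearer′ = ≤-reflexive (cong suc d≡k) ∷ All.map m<n⇒m<1+n nearer
      z∉ : All (z ≢_) (z′ ∷ zs)
      z∉ = All.map (λ { t<1+k refl → <-irrefl d≡1+k t<1+k }) nearer′

  -- Otherwise, prolong the path backwards one geodesic step towards y at a time: the path stays a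
  -- path, and so can never arrive at y, which it already contains.
  path-nearer : ∀ {a c} M {y} → Path G (a ∷ c ∷ M) → y ∈ c ∷ M → d c y < d a y
  path-nearer M {y} P y∈ = ≰⇒> (λ a≤c → never-farther (d _ y) refl a≤c M P y∈)
    where
    never-farther : ∀ k {a c} → d a y ≡ k → k ≤ d c y →
                    ∀ M → Path G (a ∷ c ∷ M) → y ∈ c ∷ M → ⊥
    never-farther zero d≡0 _ M ((a∉ ∷ _) , _) y∈ with refl ← dist≡0⇒≡ d≡0 = All.lookup a∉ y∈ refl
    never-farther (suc k) {a} {c} d≡1+k 1+k≤ M P y∈ with a′ , a~a′ , d≡k ← dist-succ d≡1+k =
      never-farther k d≡k (subst (k ≤_) (sym d≡1+k) (n≤1+n k)) (c ∷ M)
        (path-cons (acyclic T) M P (trans (adj-sym G a′ a) a~a′) a′≢c) (there y∈)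
      where
      a′≢c : a′ ≢ c
      a′≢c refl = n≮n k (subst (suc k ≤_) d≡k 1+k≤)

  nearer-neighbour-unique : adj G x w ≡ true → adj G x w′ ≡ true →
                            d w y ≤ d x y → d w′ y ≤ d x y → w ≡ w′
  nearer-neighbour-unique {x} {w} {w′} {y} x~w x~w′ w≤x w′≤x with w ≟ w′
  ... | yes w≡w′ = w≡w′
  ... | no  w≢w′ with zs , (U , C) , y∈ , nearer ← geodesic w′ y =
    contradiction w≤x (<⇒≱ (path-nearer (w′ ∷ zs) path (there y∈)))
    where
    path : Path G (w ∷ x ∷ w′ ∷ zs)
    path = path-cons (acyclic T) zs (((adj⇒≢ G x~w′ ∷ farther∉ w′≤x nearer) ∷ U) , x~w′ , C)
                     (trans (adj-sym G w x) x~w) w≢w′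

  adj⇒dist-≢ : adj G x w ≡ true → d w z ≢ d x z
  adj⇒dist-≢ {x} {w} {z} x~w w≡x with zs , (U , C) , z∈ , nearer ← geodesic x z =
    <-irrefl (sym w≡x) (path-nearer zs path z∈)
    where
    w~x : adj G w x ≡ true
    w~x = trans (adj-sym G w x) x~w
    path : Path G (w ∷ x ∷ zs)
    path = ((adj⇒≢ G w~x ∷ farther∉ (≤-reflexive (sym w≡x)) nearer) ∷ U) , w~x , C

  adj⇒dist-suc : adj G x w ≡ true → ∀ z → d w z ≡ suc (d x z) ⊎ d x z ≡ suc (d w z)
  adj⇒dist-suc {x} {w} x~w z with <-cmp (d w z) (d x z)
  ... | tri< w<x _ _ = inj₂ (≤-antisym (dist-adj-≤ x~w z) w<x)
  ... | tri≈ _ w≡x _ = contradiction w≡x (adj⇒dist-≢ x~w)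
  ... | tri> _ _ x<w = inj₁ (≤-antisym (dist-adj-≤ (trans (adj-sym G w x) x~w) z) x<w)

no-suc-cycle : ∀ {a b : ℕ} → a ≡ suc b → b ≡ suc a → ⊥
no-suc-cycle refl ()

suc-shiftˡ : ∀ {a a′ b b′ c : ℕ} → a′ ≡ suc a → b′ ≡ suc b → (a + c ≡ b ⇔ a′ + c ≡ b′)
suc-shiftˡ refl refl = mk⇔ (cong suc) suc-injective

suc-shiftʳ : ∀ {a a′ b b′ c : ℕ} → a′ ≡ suc a → b′ ≡ suc b → (c + a ≡ b ⇔ c + a′ ≡ b′)
suc-shiftʳ {a} {c = c} refl refl =
  mk⇔ (λ e → trans (+-suc c a) (cong suc e)) (λ e → suc-injective (trans (sym (+-suc c a)) e))

module PathCounts {n : ℕ} (T : Tree n) where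

  open Distance T

  private
    d = dist T

  pathIndicator : Fin n → Fin n → Fin n → ℕ
  pathIndicator x y = (λ u → 𝟙 (onPath T x y u)) without y

  pathCount : Fin n → Fin n → ℕ
  pathCount x y = ∑[ u < n ] pathIndicator x y u

  pairIndicator : Fin n → Fin n → Fin n → Fin n → ℕ
  pairIndicator x y u v = 𝟙 (onPath T x v u) * 𝟙 (onPath T y u v)

  pairCount : Fin n → Fin n → ℕ
  pairCount x y = ∑[ u < n ] ∑[ v < n ] offDiagonal (pairIndicator x y) u v

  pathCount-self : ∀ x → pathCount x x ≡ 0
  pathCount-self x = ∑-zero vanishes
    where
    vanishes : ∀ u → pathIndicator x x u ≡ 0
    vanishes u with u ≟ x
    ... | yes _   = refl
    ... | no  u≢x = cong 𝟙 (onPath-false (λ xux → u≢x (between-antisym xux xxu)))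
      where
      xxu : Between x x u
      xxu = cong (_+ d x u) (dist-self x)

  pairCount-self : ∀ x → pairCount x x ≡ 0
  pairCount-self x = ∑-zero (λ u → ∑-zero (vanishes u))
    where
    vanishes : ∀ u v → offDiagonal (pairIndicator x x) u v ≡ 0
    vanishes u v with u ≟ v
    ... | yes _ = refl
    ... | no u≢v with onPath T x v u in on
    ...   | false = refl
    ...   | true rewrite onPath-false (u≢v ∘ between-antisym (onPath-sound on)) = refl

twice≡0 : ∀ A B → A + suc B + B ≡ suc A → B ≡ 0
twice≡0 A B eq = m+n≡0⇒m≡0 B (+-cancelˡ-≡ A (B + B) 0 (suc-injective (begin
  suc (A + (B + B)) ≡⟨ rearrange A B ⟩
  A + suc B + B     ≡⟨ eq ⟩
  suc A             ≡⟨ cong suc (+-identityʳ A) ⟨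
  suc (A + 0)       ∎)))
  where
  open ≡-Reasoning
  rearrange : ∀ A B → suc (A + (B + B)) ≡ A + suc B + B
  rearrange = solve-∀

twice-suc≢ : ∀ A B → A + suc B + suc B ≢ A
twice-suc≢ A B eq = m+1+n≢m A (trans (rearrange A B) eq)
  where
  rearrange : ∀ A B → A + suc (B + suc B) ≡ A + suc B + suc B
  rearrange = solve-∀

module Edge {n : ℕ} (T : Tree n) {y′ y : Fin n} (y′~y : adj (graph T) y′ y ≡ true) where

  open Distance T
  open TreeGeometry T
  open PathCounts T

  private
    G = graph T
    d = dist T
    variable
      a b c u v : Fin n

  OnYSide OnY′Side : Fin n → Set
  OnYSide  z = d z y′ ≡ suc (d z y)
  OnY′Side z = d z y ≡ suc (d z y′)

  side : ∀ z → OnYSide z ⊎ OnY′Side z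
  side z with adj⇒dist-suc y′~y z
  ... | inj₁ y-farther  = inj₂ (trans (dist-sym z y) (trans y-farther (cong suc (dist-sym y′ z))))
  ... | inj₂ y′-farther = inj₁ (trans (dist-sym z y′) (trans y′-farther (cong suc (dist-sym y z))))

  OnYSide-sym : ∀ {z} → OnYSide z → d y′ z ≡ suc (d y z)
  OnYSide-sym {z} z-side = trans (dist-sym y′ z) (trans z-side (cong suc (dist-sym z y)))

  OnY′Side-sym : ∀ {z} → OnY′Side z → d y z ≡ suc (d y′ z)
  OnY′Side-sym {z} z-side = trans (dist-sym y z) (trans z-side (cong suc (dist-sym z y′)))

  -- Otherwise c and the neighbour of b towards y would be distinct neighbours of b nearer to y′.
  crossing-edge : OnYSide b → OnY′Side c → adj G b c ≡ true → b ≡ y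
  crossing-edge {b} {c} b-side c-side b~c with d b y in b≡
  ... | zero  = dist≡0⇒≡ b≡
  ... | suc p with b′ , b~b′ , b′≡p ← dist-succ b≡ =
    contradiction (nearer-neighbour-unique b~b′ b~c b′≤b c≤b) b′≢c
    where
    open ≤-Reasoning
    b′≤b : d b′ y′ ≤ d b y′
    b′≤b = begin
      d b′ y′          ≤⟨ dist-triangle b′ y y′ ⟩
      d b′ y + d y y′  ≡⟨ cong₂ _+_ b′≡p (trans (dist-sym y y′) (dist-adj y′~y)) ⟩
      p + 1            ≡⟨ +-comm p 1 ⟩
      suc p            ≤⟨ n≤1+n (suc p) ⟩
      suc (suc p)      ≡⟨ b-side ⟨
      d b y′           ∎
    c≤b : d c y′ ≤ d b y′
    c≤b = begin
      d c y′       ≤⟨ s≤s⁻¹ (begin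
                        suc (d c y′) ≡⟨ c-side ⟨
                        d c y        ≤⟨ dist-adj-≤ (trans (adj-sym G c b) b~c) y ⟩
                        suc (d b y)  ≡⟨ cong suc b≡ ⟩
                        suc (suc p)  ∎) ⟩
      suc p        ≤⟨ n≤1+n (suc p) ⟩
      suc (suc p)  ≡⟨ b-side ⟨
      d b y′       ∎
    b′≢c : b′ ≢ c
    b′≢c refl = n≮n p (begin-strict
      p              <⟨ n<1+n p ⟩
      suc p          <⟨ n<1+n (suc p) ⟩
      suc (suc p)    ≡⟨ b-side ⟨
      d b y′         ≤⟨ dist-adj-≤ b~b′ y′ ⟩
      suc (d b′ y′)  ≡⟨ c-side ⟨
      d b′ y         ≡⟨ b′≡p ⟩
      p              ∎)

  crossing-dist : OnY′Side a → OnYSide b → d a b ≡ d a y′ + suc (d b y)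
  crossing-dist {a} a-side = by-dist (d a _) refl
    where
    by-dist : ∀ m {b} → d a b ≡ m → OnYSide b → d a b ≡ d a y′ + suc (d b y)
    by-dist zero    ab≡0 b-side with refl ← dist≡0⇒≡ ab≡0 = contradiction b-side (no-suc-cycle a-side)
    by-dist (suc m) {b} ab≡1+m b-side with c , c~b , ac≡m ← dist-pred ab≡1+m with side c
    ... | inj₂ c-side with refl ← crossing-edge b-side c-side (trans (adj-sym G b c) c~b) = begin
      d a y               ≡⟨ a-side ⟩
      suc (d a y′)        ≡⟨ +-comm 1 (d a y′) ⟩
      d a y′ + 1          ≡⟨ cong (λ k → d a y′ + suc k) (dist-self y) ⟨
      d a y′ + suc (d y y) ∎
      where open ≡-Reasoning
    ... | inj₁ c-side with adj⇒dist-suc c~b y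
    ...   | inj₁ b-farther = begin
      d a b                      ≡⟨ ab≡1+m ⟩
      suc m                      ≡⟨ cong suc (trans (sym ac≡m) (by-dist m ac≡m c-side)) ⟩
      suc (d a y′ + suc (d c y)) ≡⟨ +-suc (d a y′) (suc (d c y)) ⟨
      d a y′ + suc (suc (d c y)) ≡⟨ cong (λ k → d a y′ + suc k) b-farther ⟨
      d a y′ + suc (d b y)       ∎
      where open ≡-Reasoning
    ...   | inj₂ c-farther = contradiction (dist-triangle a y′ b) (<⇒≱ (begin-strict
      d a y′ + d y′ b                  ≡⟨ cong (d a y′ +_) (trans (dist-sym y′ b) b-side) ⟩
      d a y′ + suc (d b y)             <⟨ +-monoʳ-< (d a y′) (s≤s (≤-reflexive (sym c-farther))) ⟩
      d a y′ + suc (d c y)             ≡⟨ by-dist m ac≡m c-side ⟨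
      d a c                            <⟨ n<1+n (d a c) ⟩
      suc (d a c)                      ≡⟨ trans (cong suc ac≡m) (sym ab≡1+m) ⟩
      d a b ∎))
      where open ≤-Reasoning

  crossing-between-y : OnY′Side a → OnYSide b → Between a b y → b ≡ y
  crossing-between-y {a} {b} a-side b-side btw = dist≡0⇒≡ (twice≡0 (d a y′) (d b y) (begin
    d a y′ + suc (d b y) + d b y ≡⟨ cong (_+ d b y) (crossing-dist a-side b-side) ⟨
    d a b + d b y                ≡⟨ btw ⟩
    d a y                        ≡⟨ a-side ⟩
    suc (d a y′)                 ∎))
    where open ≡-Reasoning

  crossing-not-between-y′ : OnY′Side a → OnYSide b → ¬ Between a b y′
  crossing-not-between-y′ {a} {b} a-side b-side btw = twice-suc≢ (d a y′) (d b y) (begin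
    d a y′ + suc (d b y) + suc (d b y) ≡⟨ cong₂ _+_ (crossing-dist a-side b-side) b-side ⟨
    d a b + d b y′                     ≡⟨ btw ⟩
    d a y′                             ∎)
    where open ≡-Reasoning

  recrossing-not-between : OnY′Side a → OnYSide u → OnY′Side v → ¬ Between a u v
  recrossing-not-between {a} {u} {v} a-side u-side v-side btw =
    contradiction (dist-triangle a y′ v) (<⇒≱ (begin-strict
      d a y′ + d y′ v                               ≡⟨ cong (d a y′ +_) (dist-sym y′ v) ⟩
      d a y′ + d v y′
        <⟨ +-mono-≤-< (m≤m+n (d a y′) _) (m<m+n (d v y′) z<s) ⟩
      d a y′ + suc (d u y) + (d v y′ + suc (d u y))
        ≡⟨ cong₂ _+_ (crossing-dist a-side u-side) (crossing-dist v-side u-side) ⟨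
      d a u + d v u                                 ≡⟨ cong (d a u +_) (dist-sym v u) ⟩
      d a u + d u v                                 ≡⟨ btw ⟩
      d a v                                         ∎))
    where open ≤-Reasoning

  module _ {x : Fin n} (x-side : OnY′Side x) where

    between-x-y⇔between-x-y′ : u ≢ y → Between x u y ⇔ Between x u y′
    between-x-y⇔between-x-y′ {u} u≢y with side u
    ... | inj₁ u-side = mk⇔ (λ btw → contradiction (crossing-between-y x-side u-side btw) u≢y)
                            (λ btw → contradiction btw (crossing-not-between-y′ x-side u-side))
    ... | inj₂ u-side = ⇔.sym (suc-shiftʳ u-side x-side)

    between-x-y⇒¬between-y′-y : u ≢ y → Between x u y → ¬ Between y′ y u
    between-x-y⇒¬between-y′-y {u} u≢y btw btw′ = u≢y (crossing-between-y x-side u-side btw)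
      where
      u-side : OnYSide u
      u-side = begin
        d u y′          ≡⟨ dist-sym u y′ ⟩
        d y′ u          ≡⟨ btw′ ⟨
        d y′ y + d y u  ≡⟨ cong₂ _+_ (dist-adj y′~y) (dist-sym y u) ⟩
        suc (d u y)     ∎
        where open ≡-Reasoning

    between-y⇔between-y′ : v ≢ y → Between x u v → Between y v u ⇔ Between y′ v u
    between-y⇔between-y′ {v} {u} v≢y btw with side u | side v
    ... | inj₁ u-side | inj₁ v-side = suc-shiftˡ (OnYSide-sym v-side) (OnYSide-sym u-side)
    ... | inj₂ u-side | inj₂ v-side = ⇔.sym (suc-shiftˡ (OnY′Side-sym v-side) (OnY′Side-sym u-side))
    ... | inj₂ u-side | inj₁ v-side =
      mk⇔ (λ btw′ → contradiction (crossing-between-y u-side v-side (between-sym btw′)) v≢y)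
          (λ btw′ → contradiction (between-sym btw′) (crossing-not-between-y′ u-side v-side))
    ... | inj₁ u-side | inj₂ v-side = contradiction btw (recrossing-not-between x-side u-side v-side)

    ¬between-x-y-y′ : ¬ Between x y y′
    ¬between-x-y-y′ xyy′ = n≮n (d x y′) (begin-strict
      d x y′          <⟨ n<1+n (d x y′) ⟩
      suc (d x y′)    ≡⟨ x-side ⟨
      d x y           ≤⟨ m≤m+n (d x y) (d y y′) ⟩
      d x y + d y y′  ≡⟨ xyy′ ⟩
      d x y′          ∎)
      where open ≤-Reasoning

    pathCount-step : pathCount x y ≡ suc (pathCount x y′)
    pathCount-step = begin
      pathCount x y          ≡⟨ ∑-without-cong (λ _ → cong 𝟙 ∘ onPath-cong ∘ between-x-y⇔between-x-y′) ⟩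
      rest                   ≡⟨ +-identityʳ rest ⟨
      rest + 0               ≡⟨ cong (rest +_) (cong 𝟙 (onPath-false ¬between-x-y-y′)) ⟨
      rest + g y             ≡⟨ ∑-without g y ⟨
      ∑[ u < n ] g u         ≡⟨ ∑-without g y′ ⟩
      pathCount x y′ + g y′  ≡⟨ cong (pathCount x y′ +_) (cong 𝟙 (onPath-true between-x-y′-y′)) ⟩
      pathCount x y′ + 1     ≡⟨ +-comm (pathCount x y′) 1 ⟩
      suc (pathCount x y′)   ∎
      where
      open ≡-Reasoning
      g : Fin n → ℕ
      rest : ℕ
      rest = ∑[ u < n ] (g without y) u
      g u = 𝟙 (onPath T x y′ u)
      between-x-y′-y′ : Between x y′ y′
      between-x-y′-y′ = trans (cong (d x y′ +_) (dist-self y′)) (+-identityʳ (d x y′))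

    pairIndicator-step : ∀ u v → v ≢ y → pairIndicator x y u v ≡ pairIndicator x y′ u v
    pairIndicator-step u v v≢y with onPath T x v u in on
    ... | false = refl
    ... | true  = cong (λ b → 𝟙 b + 0) (onPath-cong (between-y⇔between-y′ v≢y (onPath-sound on)))

    column-y : ∀ u → offDiagonal (pairIndicator x y) u y ≡ pathIndicator x y u
    column-y u = without-cong {f = λ u → pairIndicator x y u y} {g = λ u → 𝟙 (onPath T x y u)} u
      (λ _ → trans (cong (λ b → 𝟙 (onPath T x y u) * 𝟙 b) (onPath-true (cong (_+ d y u) (dist-self y))))
                   (*-identityʳ _))

    column-y-vanishes : ∀ u → offDiagonal (pairIndicator x y′) u y ≡ 0
    column-y-vanishes u with u ≟ y
    ... | yes _ = refl
    ... | no u≢y with onPath T x y u in on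
    ...   | false = refl
    ...   | true rewrite onPath-false (between-x-y⇒¬between-y′-y u≢y (onPath-sound on)) = refl

    row-step : ∀ u → ∑[ v < n ] offDiagonal (pairIndicator x y) u v ≡
                     ∑[ v < n ] offDiagonal (pairIndicator x y′) u v + pathIndicator x y u
    row-step u = begin
      ∑[ v < n ] row u v                        ≡⟨ ∑-without (row u) y ⟩
      ∑[ v < n ] (row u without y) v + row u y  ≡⟨ cong₂ _+_ (∑-without-cong (other-columns u)) (column-y u) ⟩
      rest + pathIndicator x y u                ≡⟨ cong (_+ pathIndicator x y u) (begin
        rest                                      ≡⟨ +-identityʳ rest ⟨
        rest + 0                                  ≡⟨ cong (rest +_) (column-y-vanishes u) ⟨
        rest + row′ u y                           ≡⟨ ∑-without (row′ u) y ⟨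
        ∑[ v < n ] row′ u v                       ∎) ⟩
      ∑[ v < n ] row′ u v + pathIndicator x y u ∎
      where
      open ≡-Reasoning
      row row′ : Fin n → Fin n → ℕ
      row  = offDiagonal (pairIndicator x y)
      row′ = offDiagonal (pairIndicator x y′)
      other-columns : ∀ u v → v ≢ y → row u v ≡ row′ u v
      other-columns u v v≢y = cong (if does (u ≟ v) then 0 else_) (pairIndicator-step u v v≢y)
      rest : ℕ
      rest = ∑[ v < n ] (row′ u without y) v

    pairCount-step : pairCount x y ≡ pairCount x y′ + pathCount x y
    pairCount-step = trans (sum-cong-≗ row-step) (∑-distrib-+ _ (pathIndicator x y))

module PathCountValues {n : ℕ} (T : Tree n) where

  open Distance T
  open PathCounts T

  private
    d = dist T

  pathCount≡dist : ∀ x y → pathCount x y ≡ d x y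
  pathCount≡dist x y = by-dist (d x y) y refl
    where
    by-dist : ∀ k y → d x y ≡ k → pathCount x y ≡ k
    by-dist zero    y xy≡0 with refl ← dist≡0⇒≡ xy≡0 = pathCount-self x
    by-dist (suc k) y xy≡1+k with y′ , y′~y , xy′≡k ← dist-pred xy≡1+k =
      trans (Edge.pathCount-step T y′~y (trans xy≡1+k (cong suc (sym xy′≡k))))
            (cong suc (by-dist k y′ xy′≡k))

  pairCount-formula : ∀ x y → 2 * pairCount x y ≡ d x y + d x y * d x y
  pairCount-formula x y = by-dist (d x y) y refl
    where
    by-dist : ∀ k y → d x y ≡ k → 2 * pairCount x y ≡ k + k * k
    by-dist zero    y xy≡0 with refl ← dist≡0⇒≡ xy≡0 = cong (2 *_) (pairCount-self x)
    by-dist (suc k) y xy≡1+k with y′ , y′~y , xy′≡k ← dist-pred xy≡1+k = begin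
      2 * pairCount x y                        ≡⟨ cong (2 *_) (Edge.pairCount-step T y′~y x-side) ⟩
      2 * (pairCount x y′ + pathCount x y)     ≡⟨ *-distribˡ-+ 2 (pairCount x y′) (pathCount x y) ⟩
      2 * pairCount x y′ + 2 * pathCount x y
        ≡⟨ cong₂ (λ a b → a + 2 * b) (by-dist k y′ xy′≡k) (trans (pathCount≡dist x y) xy≡1+k) ⟩
      k + k * k + 2 * suc k                    ≡⟨ square-step k ⟩
      suc k + suc k * suc k                    ∎
      where
      open ≡-Reasoning
      x-side : d x y ≡ suc (d x y′)
      x-side = trans xy≡1+k (cong suc (sym xy′≡k))
      square-step : ∀ k → k + k * k + 2 * suc k ≡ suc k + suc k * suc k
      square-step = solve-∀

module DoubleCounting {n : ℕ} (T : Tree n) where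

  open Distance T
  open PathCounts T
  open PathCountValues T

  private
    d = dist T
    P = peripheral T

  sumPairs≡∑upper : ∀ h → sumPairs T h ≡ ∑[ x < n ] ∑[ y < n ] upper h x y
  sumPairs≡∑upper h = trans (sum-map-allFin (λ x → listSum (map (upper h x) (allFin n))))
                            (sum-cong-≗ (λ x → sum-map-allFin (upper h x)))

  a₁*a₂ : Fin n → Fin n → ℕ
  a₁*a₂ u v = a₁ T u v * a₂ T u v

  peripheralPair : Fin n → Fin n → ℕ
  peripheralPair x y = 𝟙 (P x ∧ P y)

  a₁*a₂≡∑∑ : ∀ u v →
             a₁*a₂ u v ≡ ∑[ x < n ] ∑[ y < n ] (peripheralPair x y * pairIndicator x y u v)
  a₁*a₂≡∑∑ u v = begin
    a₁ T u v * a₂ T u v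
      ≡⟨ cong₂ _*_ (sum-map-allFin on-x) (sum-map-allFin on-y) ⟩
    (∑[ x < n ] 𝟙 (P x ∧ onPath T x v u)) * (∑[ y < n ] 𝟙 (P y ∧ onPath T y u v))
      ≡⟨ ∑*∑ on-x on-y ⟩
    ∑[ x < n ] ∑[ y < n ] (𝟙 (P x ∧ onPath T x v u) * 𝟙 (P y ∧ onPath T y u v))
      ≡⟨ sum-cong-≗ (λ x → sum-cong-≗ (λ y → 𝟙-∧-* (P x) (P y) (onPath T x v u) (onPath T y u v))) ⟩
    ∑[ x < n ] ∑[ y < n ] (peripheralPair x y * pairIndicator x y u v) ∎
    where
    open ≡-Reasoning
    on-x on-y : Fin n → ℕ
    on-x x = 𝟙 (P x ∧ onPath T x v u)
    on-y y = 𝟙 (P y ∧ onPath T y u v)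

  ∑-offDiagonal-a₁*a₂ : ∑[ u < n ] ∑[ v < n ] offDiagonal a₁*a₂ u v ≡
                        ∑[ x < n ] ∑[ y < n ] (peripheralPair x y * pairCount x y)
  ∑-offDiagonal-a₁*a₂ = begin
    ∑[ u < n ] ∑[ v < n ] offDiagonal a₁*a₂ u v
      ≡⟨ sum-cong-≗ (λ u → sum-cong-≗ (λ v → expand u v)) ⟩
    ∑[ u < n ] ∑[ v < n ] ∑[ x < n ] ∑[ y < n ] (peripheralPair x y * offDiagonal (pairIndicator x y) u v)
      ≡⟨ ∑∑-comm (λ u v x y → peripheralPair x y * offDiagonal (pairIndicator x y) u v) ⟩
    ∑[ x < n ] ∑[ y < n ] ∑[ u < n ] ∑[ v < n ] (peripheralPair x y * offDiagonal (pairIndicator x y) u v)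
      ≡⟨ sum-cong-≗ (λ x → sum-cong-≗ (λ y → factor x y)) ⟨
    ∑[ x < n ] ∑[ y < n ] (peripheralPair x y * pairCount x y) ∎
    where
    open ≡-Reasoning
    expand : ∀ u v → offDiagonal a₁*a₂ u v ≡
                     ∑[ x < n ] ∑[ y < n ] (peripheralPair x y * offDiagonal (pairIndicator x y) u v)
    expand u v = trans (cong (if does (u ≟ v) then 0 else_) (a₁*a₂≡∑∑ u v))
                       (offDiagonal-∑∑ peripheralPair pairIndicator u v)
    factor : ∀ x y → peripheralPair x y * pairCount x y ≡
                     ∑[ u < n ] ∑[ v < n ] (peripheralPair x y * offDiagonal (pairIndicator x y) u v)
    factor x y = *-distribˡ-∑∑ (peripheralPair x y) (offDiagonal (pairIndicator x y))

  peripheralDist : Fin n → Fin n → ℕ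
  peripheralDist x y = if P x ∧ P y then d x y + d x y * d x y else 0

  peripheralDist-sym : ∀ x y → peripheralDist x y ≡ peripheralDist y x
  peripheralDist-sym x y rewrite ∧-comm (P x) (P y) | dist-sym x y = refl

  offDiagonal-peripheralDist : ∀ x y → offDiagonal peripheralDist x y ≡ peripheralDist x y
  offDiagonal-peripheralDist x y with x ≟ y
  ... | no  _ = refl
  ... | yes refl rewrite dist-self x with P x ∧ P x
  ...   | true  = refl
  ...   | false = refl

  peripheralDist≡2*pairCount : ∀ x y → peripheralDist x y ≡ 2 * (peripheralPair x y * pairCount x y)
  peripheralDist≡2*pairCount x y with P x ∧ P y
  ... | false = refl
  ... | true  = trans (sym (pairCount-formula x y)) (cong (2 *_) (sym (*-identityˡ (pairCount x y))))

  sumPairs-peripheralDist : sumPairs T peripheralDist ≡ 2 * sumPairs T a₁*a₂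
  sumPairs-peripheralDist = *-cancelˡ-≡ _ _ 2 (begin
    2 * sumPairs T peripheralDist
      ≡⟨ cong (2 *_) (sumPairs≡∑upper peripheralDist) ⟩
    2 * ∑[ x < n ] ∑[ y < n ] upper peripheralDist x y
      ≡⟨ ∑-offDiagonal-sym peripheralDist peripheralDist-sym ⟨
    ∑[ x < n ] ∑[ y < n ] offDiagonal peripheralDist x y
      ≡⟨ sum-cong-≗ (λ x → sum-cong-≗ (λ y →
           trans (offDiagonal-peripheralDist x y) (peripheralDist≡2*pairCount x y))) ⟩
    ∑[ x < n ] ∑[ y < n ] (2 * (peripheralPair x y * pairCount x y))
      ≡⟨ *-distribˡ-∑∑ 2 (λ x y → peripheralPair x y * pairCount x y) ⟨
    2 * ∑[ x < n ] ∑[ y < n ] (peripheralPair x y * pairCount x y)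
      ≡⟨ cong (2 *_) ∑-offDiagonal-a₁*a₂ ⟨
    2 * ∑[ u < n ] ∑[ v < n ] offDiagonal a₁*a₂ u v
      ≡⟨ cong (2 *_) (∑-offDiagonal-sym a₁*a₂ (λ u v → *-comm (a₁ T u v) (a₂ T u v))) ⟩
    2 * (2 * ∑[ u < n ] ∑[ v < n ] upper a₁*a₂ u v)
      ≡⟨ cong (λ m → 2 * (2 * m)) (sumPairs≡∑upper a₁*a₂) ⟨
    2 * (2 * sumPairs T a₁*a₂) ∎)
    where open ≡-Reasoning

-- The identity holds for every tree, however small.
mainTheorem10 : (n : ℕ) → 2 ≤ n → (T : Tree n) →
    PWW T ≡ sumPairs T (λ u v → a₁ T u v * a₂ T u v)
mainTheorem10 n _ T = begin
  PWW T                              ≡⟨ cong (_/ 2) sumPairs-peripheralDist ⟩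
  2 * sumPairs T a₁*a₂ / 2           ≡⟨ cong (_/ 2) (*-comm 2 (sumPairs T a₁*a₂)) ⟩
  sumPairs T a₁*a₂ * 2 / 2           ≡⟨ m*n/n≡m (sumPairs T a₁*a₂) 2 ⟩
  sumPairs T a₁*a₂                   ∎
  where
  open ≡-Reasoning
  open DoubleCounting T
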